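{- Let $p/q$ be a rational number in lowest terms ($q\geq 1$), and let its continued fraction expansion be $\frac{p}{q}=[a_0;a_1,a_2,\ldots,a_{2k}]$ for some integer $k\geq 0$ (with $a_0\in\mathbb{Z}$ and $a_1,\ldots,a_{2k}$ positive integers). Let $q_n$ denote the denominators of the convergents, defined by $q_{ -1}=0$, $q_0=1$, $q_n=a_nq_{n-1}+q_{n-2}$. Let $(z_n)_{n\geq 1}$ be any sequence of positive integers. Define sequences $(x_n)_{n\geq1}$ and $(y_n)_{n\geq 0}$ by $$x_1=q,\qquad y_0=q_{2k-1}+1,\qquad x_{n+1}=x_n\,y_{n-1}\,(x_nz_n+1)\ \ (n\geq 1),\qquad y_n=\frac{x_{n+1}}{x_n}\ \ (n\geq 1).$$ Then for all $n\geq 1$ the partial sums $$S_n:=\frac{p}{q}+\sum_{j=2}^n\frac{1}{x_j}$$ satisfy $$S_n=[a_0;a_1,\ldots,a_{2(k+n-1)}],$$ where the coefficients after $a_{2k}$ are given by $a_{2k+2j-1}=y_{j-1}z_j$ and $a_{2k+2j}=x_j$ for $j\geq 1$.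
   Context: Notation: $[a_0;a_1,\ldots,a_n]=a_0+\cfrac{1}{a_1+\cfrac{1}{a_2+\cdots+\cfrac{1}{a_n}}}$ denotes a finite continued fraction. The sequences $(x_n)$ and $(y_n)$ consist of positive integers, and $x_n$ divides $x_{n+1}$ for all $n\geq1$. -}

module Defs where

open import Data.Nat using (ℕ; zero; suc; _+_; _*_)
open import Data.Integer using (ℤ)
open import Data.List using (List; []; _∷_; applyUpTo)
open import Data.Rational using (ℚ; 0ℚ; 1/_; _≟_; ≢-nonZero) renaming (_+_ to _+ℚ_)
open import Data.Rational using () renaming (_/_ to _/ℚ_)
open import Relation.Nullary using (yes; no)
import Data.Integer as ℤ

-- Reciprocal of a rational, made total by sending 0 to 0.
-- (Only ever applied to nonzero values in the theorem.)
inv : ℚ → ℚ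
inv r with r ≟ 0ℚ
... | yes _ = 0ℚ
... | no r≢0 = (1/ r) {{≢-nonZero r≢0}}

ℕ→ℚ : ℕ → ℚ
ℕ→ℚ n = ℤ.+ n /ℚ 1

cfTail : ℕ → List ℕ → ℚ
cfTail b []       = ℕ→ℚ b
cfTail b (c ∷ cs) = ℕ→ℚ b +ℚ inv (cfTail c cs)

cf : ℤ → List ℕ → ℚ
cf a0 []       = a0 /ℚ 1
cf a0 (b ∷ bs) = (a0 /ℚ 1) +ℚ inv (cfTail b bs)

-- partial quotients a_1, ..., a_m of a sequence a (a i = a_i for i ≥ 1)
coeffs : (ℕ → ℕ) → ℕ → List ℕ
coeffs a m = applyUpTo (λ i → a (suc i)) m

-- shifted convergent denominators: den a (m + 1) = q_m, den a 0 = q_{-1}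
-- q_{-1} = 0, q_0 = 1, q_n = a_n q_{n-1} + q_{n-2}
den : (ℕ → ℕ) → ℕ → ℕ
den a zero = 0
den a (suc zero) = 1
den a (suc (suc n)) = a (suc n) * den a (suc n) + den a n

-- S_n = r + Σ_{j=2}^{n} 1/x_j   (for n ≥ 1; S 0 is set to r and unused)
S : ℚ → (ℕ → ℕ) → ℕ → ℚ
S r x zero = r
S r x (suc zero) = r
S r x (suc (suc n)) = S r x (suc n) +ℚ inv (ℕ→ℚ (x (suc (suc n))))

module Submission where

-- Write p_m / q_m for the convergents of [a₀; a₁, a₂, …]. Since p_{2k} / q_{2k} = p / q is in
-- lowest terms, q_{2k} = q = x₁. Put m = 2(k + n − 1). The choice y_{n−1} = q_{m−1} + 1 together
-- with a_{m+1} = y_{n−1} z_n and a_{m+2} = x_n makes q_{m+2} = x_{n+1} and y_n = q_{m+1} + 1, so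
-- the situation repeats. The determinant identity p_{m+1} q_m − p_m q_{m+1} = 1 then gives
-- p_{m+2} / q_{m+2} − p_m / q_m = a_{m+2} / (q_m q_{m+2}) = 1 / x_{n+1}: the convergents of even
-- order 2(k + n − 1) are exactly the partial sums S_n.

open import Defs
open import Data.Nat using (ℕ; zero; suc; _+_; _*_; _≤_; _<_; _∸_; s≤s; z≤n)
import Data.Nat as ℕ
import Data.Nat.Properties as ℕP
open import Data.Nat.Coprimality using (Coprime; coprime-divisor)
import Data.Nat.Coprimality as Coprime
import Data.Nat.Divisibility as ℕD
open import Data.Nat.Tactic.RingSolver using () renaming (solve to solveℕ)
open import Data.Integer using (ℤ)
import Data.Integer as ℤ
import Data.Integer.Properties as ℤP
import Data.Integer.Divisibility.Signed as ℤD
open import Data.Integer.Tactic.RingSolver using () renaming (solve to solveℤ)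
open import Data.Rational
  using (ℚ; mkℚ; ↧ₙ_; 0ℚ; 1ℚ; Positive; NonNegative; toℚᵘ; ≢-nonZero)
  renaming (_+_ to _+ℚ_; _*_ to _*ℚ_; _/_ to _/ℚ_)
import Data.Rational as ℚ
import Data.Rational.Properties as ℚP
open import Data.Rational.Solver using (module +-*-Solver)
import Data.Rational.Unnormalised as ℚᵘ
import Data.Rational.Unnormalised.Properties as ℚᵘP
open import Data.List using (List; []; _∷_; _∷ʳ_)
import Data.List.Properties as ListP
open import Data.Sum using (inj₁; inj₂)
open import Data.Product using (_,_)
open import Data.Empty using (⊥-elim)
open import Relation.Nullary using (yes; no)
open import Relation.Binary.PropositionalEquality
open import Function using (_∘_)

ℤ→ℚ : ℤ → ℚ
ℤ→ℚ i = i /ℚ 1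

ℤ→ℚ-mkℚ : ∀ i → ℤ→ℚ i ≡ mkℚ i 0 (Coprime.sym (Coprime.1-coprimeTo _))
ℤ→ℚ-mkℚ i = ℚP.↥p/↧p≡p (mkℚ i 0 (Coprime.sym (Coprime.1-coprimeTo _)))

toℚᵘ-ℤ→ℚ : ∀ i → toℚᵘ (ℤ→ℚ i) ≡ ℚᵘ.mkℚᵘ i 0
toℚᵘ-ℤ→ℚ i = cong toℚᵘ (ℤ→ℚ-mkℚ i)

ℤ→ℚ-+ : ∀ i j → ℤ→ℚ (i ℤ.+ j) ≡ ℤ→ℚ i +ℚ ℤ→ℚ j
ℤ→ℚ-+ i j = ℚP.toℚᵘ-injective (ℚᵘP.≃-trans sum (ℚᵘP.≃-sym (ℚP.toℚᵘ-homo-+ (ℤ→ℚ i) (ℤ→ℚ j))))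
  where
  sum : toℚᵘ (ℤ→ℚ (i ℤ.+ j)) ℚᵘ.≃ toℚᵘ (ℤ→ℚ i) ℚᵘ.+ toℚᵘ (ℤ→ℚ j)
  sum rewrite toℚᵘ-ℤ→ℚ (i ℤ.+ j) | toℚᵘ-ℤ→ℚ i | toℚᵘ-ℤ→ℚ j = ℚᵘ.*≡* cross
    where
    cross : (i ℤ.+ j) ℤ.* ℤ.+ 1 ≡ (i ℤ.* ℤ.+ 1 ℤ.+ j ℤ.* ℤ.+ 1) ℤ.* ℤ.+ 1
    cross = solveℤ (i ∷ j ∷ [])

ℤ→ℚ-* : ∀ i j → ℤ→ℚ (i ℤ.* j) ≡ ℤ→ℚ i *ℚ ℤ→ℚ j
ℤ→ℚ-* i j = ℚP.toℚᵘ-injective (ℚᵘP.≃-trans product (ℚᵘP.≃-sym (ℚP.toℚᵘ-homo-* (ℤ→ℚ i) (ℤ→ℚ j))))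
  where
  product : toℚᵘ (ℤ→ℚ (i ℤ.* j)) ℚᵘ.≃ toℚᵘ (ℤ→ℚ i) ℚᵘ.* toℚᵘ (ℤ→ℚ j)
  product rewrite toℚᵘ-ℤ→ℚ (i ℤ.* j) | toℚᵘ-ℤ→ℚ i | toℚᵘ-ℤ→ℚ j = ℚᵘ.*≡* refl

ℕ→ℚ-+ : ∀ m n → ℕ→ℚ (m + n) ≡ ℕ→ℚ m +ℚ ℕ→ℚ n
ℕ→ℚ-+ m n = trans (cong ℤ→ℚ (ℤP.pos-+ m n)) (ℤ→ℚ-+ (ℤ.+ m) (ℤ.+ n))

ℕ→ℚ-* : ∀ m n → ℕ→ℚ (m * n) ≡ ℕ→ℚ m *ℚ ℕ→ℚ n
ℕ→ℚ-* m n = trans (cong ℤ→ℚ (ℤP.pos-* m n)) (ℤ→ℚ-* (ℤ.+ m) (ℤ.+ n))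

ℕ→ℚ-nonNeg : ∀ n → NonNegative (ℕ→ℚ n)
ℕ→ℚ-nonNeg n rewrite ℤ→ℚ-mkℚ (ℤ.+ n) = _

ℕ→ℚ-pos : ∀ {n} → n ≢ 0 → Positive (ℕ→ℚ n)
ℕ→ℚ-pos {zero} n≢0 = ⊥-elim (n≢0 refl)
ℕ→ℚ-pos {suc n} _ rewrite ℤ→ℚ-mkℚ (ℤ.+ suc n) = _

pos⇒≢0 : ∀ r → Positive r → r ≢ 0ℚ
pos⇒≢0 r r>0 = ℚP.<⇒≢ (ℚP.positive⁻¹ r {{r>0}}) ∘ sym

inv-inverseˡ : ∀ {r} → r ≢ 0ℚ → inv r *ℚ r ≡ 1ℚ
inv-inverseˡ {r} r≢0 with r ℚ.≟ 0ℚ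
... | yes r≡0 = ⊥-elim (r≢0 r≡0)
... | no r≢0 = ℚP.*-inverseˡ r {{≢-nonZero r≢0}}

inv-pos : ∀ r → Positive r → Positive (inv r)
inv-pos r r>0 with r ℚ.≟ 0ℚ
... | yes r≡0 = ⊥-elim (pos⇒≢0 r r>0 r≡0)
... | no r≢0 = ℚP.1/pos⇒pos r {{r>0}}

absorb-inverse : ∀ {t i} → i *ℚ t ≡ 1ℚ → ∀ c u v →
                 (u *ℚ (c +ℚ i) +ℚ v) *ℚ t ≡ (c *ℚ u +ℚ v) *ℚ t +ℚ u
absorb-inverse {t} {i} it≡1 c u v = begin
  (u *ℚ (c +ℚ i) +ℚ v) *ℚ t
    ≡⟨ solve 5 (λ t i c u v → (u :* (c :+ i) :+ v) :* t := (c :* u :+ v) :* t :+ u :* (i :* t))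
               refl t i c u v ⟩
  (c *ℚ u +ℚ v) *ℚ t +ℚ u *ℚ (i *ℚ t) ≡⟨ cong (λ w → (c *ℚ u +ℚ v) *ℚ t +ℚ u *ℚ w) it≡1 ⟩
  (c *ℚ u +ℚ v) *ℚ t +ℚ u *ℚ 1ℚ       ≡⟨ cong ((c *ℚ u +ℚ v) *ℚ t +ℚ_) (ℚP.*-identityʳ u) ⟩
  (c *ℚ u +ℚ v) *ℚ t +ℚ u             ∎
  where
  open ≡-Reasoning
  open +-*-Solver

add-inverse-by-cross-multiplication : ∀ {u w i j A B p p′} → i *ℚ w ≡ 1ℚ → j *ℚ u ≡ 1ℚ →
  A *ℚ u ≡ p → B *ℚ w ≡ p′ → p′ *ℚ u ≡ p *ℚ w +ℚ u → B ≡ A +ℚ i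
add-inverse-by-cross-multiplication {u} {w} {i} {j} {A} {B} {p} {p′} iw≡1 ju≡1 Au≡p Bw≡p′ cross =
  begin
    B                                        ≡⟨ sym (ℚP.*-identityʳ B) ⟩
    B *ℚ 1ℚ                                  ≡⟨ cong (B *ℚ_) (sym (cong₂ _*ℚ_ iw≡1 ju≡1)) ⟩
    B *ℚ ((i *ℚ w) *ℚ (j *ℚ u))
      ≡⟨ solve 5 (λ B i w j u → B :* ((i :* w) :* (j :* u)) := (B :* w) :* u :* (i :* j))
                 refl B i w j u ⟩
    (B *ℚ w) *ℚ u *ℚ (i *ℚ j)                ≡⟨ cong (λ b → b *ℚ u *ℚ (i *ℚ j)) Bw≡p′ ⟩
    p′ *ℚ u *ℚ (i *ℚ j)                      ≡⟨ cong (_*ℚ (i *ℚ j)) cross ⟩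
    (p *ℚ w +ℚ u) *ℚ (i *ℚ j)                ≡⟨ cong (λ a → (a *ℚ w +ℚ u) *ℚ (i *ℚ j)) (sym Au≡p) ⟩
    ((A *ℚ u) *ℚ w +ℚ u) *ℚ (i *ℚ j)
      ≡⟨ solve 5 (λ A i w j u → ((A :* u) :* w :+ u) :* (i :* j)
                                 := A :* ((i :* w) :* (j :* u)) :+ i :* (j :* u))
                 refl A i w j u ⟩
    A *ℚ ((i *ℚ w) *ℚ (j *ℚ u)) +ℚ i *ℚ (j *ℚ u)
      ≡⟨ cong₂ (λ e f → A *ℚ (e *ℚ f) +ℚ i *ℚ f) iw≡1 ju≡1 ⟩
    A *ℚ 1ℚ +ℚ i *ℚ 1ℚ                       ≡⟨ cong₂ _+ℚ_ (ℚP.*-identityʳ A) (ℚP.*-identityʳ i) ⟩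
    A +ℚ i                                   ∎
  where
  open ≡-Reasoning
  open +-*-Solver

↧ₙ-unique : ∀ r (p : ℤ) (q : ℕ) → r *ℚ ℕ→ℚ q ≡ ℤ→ℚ p → Coprime q ℤ.∣ p ∣ → ↧ₙ r ≡ q
↧ₙ-unique r@(mkℚ n d-1 n⊥d) p q rq≡p q⊥p = ℕD.∣-antisym d∣q q∣d
  where
  d = suc d-1
  rq≃p : ℚᵘ.mkℚᵘ p 0 ℚᵘ.≃ ℚᵘ.mkℚᵘ n d-1 ℚᵘ.* ℚᵘ.mkℚᵘ (ℤ.+ q) 0
  rq≃p = subst₂ (λ u v → u ℚᵘ.≃ toℚᵘ r ℚᵘ.* v) (toℚᵘ-ℤ→ℚ p) (toℚᵘ-ℤ→ℚ (ℤ.+ q))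
           (ℚᵘP.≃-trans (ℚᵘP.≃-reflexive (cong toℚᵘ (sym rq≡p))) (ℚP.toℚᵘ-homo-* r (ℕ→ℚ q)))
  cross : n ℤ.* ℤ.+ q ≡ p ℤ.* ℤ.+ d
  cross = begin
    n ℤ.* ℤ.+ q                ≡⟨ sym (ℤP.*-identityʳ _) ⟩
    n ℤ.* ℤ.+ q ℤ.* ℤ.+ 1      ≡⟨ sym (ℚᵘP.drop-*≡* rq≃p) ⟩
    p ℤ.* ℤ.+ (d * 1)          ≡⟨ cong (λ e → p ℤ.* ℤ.+ e) (ℕP.*-identityʳ d) ⟩
    p ℤ.* ℤ.+ d                ∎
    where open ≡-Reasoning
  ∣n∣q≡∣p∣d : ℤ.∣ n ∣ * q ≡ ℤ.∣ p ∣ * d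
  ∣n∣q≡∣p∣d = trans (sym (ℤP.abs-* n (ℤ.+ q))) (trans (cong ℤ.∣_∣ cross) (ℤP.abs-* p (ℤ.+ d)))
  d∣q : d ℕD.∣ q
  d∣q = coprime-divisor (Coprime.sym (Coprime.recompute n⊥d)) (ℕD.divides ℤ.∣ p ∣ ∣n∣q≡∣p∣d)
  q∣d : q ℕD.∣ d
  q∣d = coprime-divisor q⊥p (ℕD.divides ℤ.∣ n ∣ (sym ∣n∣q≡∣p∣d))

cfTailWith : List ℕ → ℚ → ℚ
cfTailWith []       t = t
cfTailWith (c ∷ cs) t = ℕ→ℚ c +ℚ inv (cfTailWith cs t)

cfTailWith-∷ʳ : ∀ cs c t → cfTailWith (cs ∷ʳ c) t ≡ cfTailWith cs (ℕ→ℚ c +ℚ inv t)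
cfTailWith-∷ʳ []       c t = refl
cfTailWith-∷ʳ (d ∷ cs) c t = cong (λ s → ℕ→ℚ d +ℚ inv s) (cfTailWith-∷ʳ cs c t)

cfTail-∷ʳ : ∀ b cs c → cfTail b (cs ∷ʳ c) ≡ ℕ→ℚ b +ℚ inv (cfTailWith cs (ℕ→ℚ c))
cfTail-∷ʳ b []       c = refl
cfTail-∷ʳ b (d ∷ cs) c = cong (λ s → ℕ→ℚ b +ℚ inv s) (cfTail-∷ʳ d cs c)

cfWith : ℤ → List ℕ → ℚ → ℚ
cfWith a0 cs t = ℤ→ℚ a0 +ℚ inv (cfTailWith cs t)

cfWith-∷ʳ : ∀ a0 cs c t → cfWith a0 (cs ∷ʳ c) t ≡ cfWith a0 cs (ℕ→ℚ c +ℚ inv t)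
cfWith-∷ʳ a0 cs c t = cong (λ s → ℤ→ℚ a0 +ℚ inv s) (cfTailWith-∷ʳ cs c t)

cf-∷ʳ : ∀ a0 cs c → cf a0 (cs ∷ʳ c) ≡ cfWith a0 cs (ℕ→ℚ c)
cf-∷ʳ a0 []       c = refl
cf-∷ʳ a0 (b ∷ cs) c = cong (λ s → ℤ→ℚ a0 +ℚ inv s) (cfTail-∷ʳ b cs c)

module Convergents (a0 : ℤ) (a : ℕ → ℕ) where

  convergent : ℕ → ℚ
  convergent m = cf a0 (coeffs a m)

  coeffs-suc : ∀ m → coeffs a (suc m) ≡ coeffs a m ∷ʳ a (suc m)
  coeffs-suc m = sym (ListP.applyUpTo-∷ʳ (λ i → a (suc i)) m)

  convergent-suc : ∀ m → convergent (suc m) ≡ cfWith a0 (coeffs a m) (ℕ→ℚ (a (suc m)))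
  convergent-suc m = trans (cong (cf a0) (coeffs-suc m)) (cf-∷ʳ a0 (coeffs a m) (a (suc m)))

  cfWith-suc : ∀ m t →
    cfWith a0 (coeffs a (suc m)) t ≡ cfWith a0 (coeffs a m) (ℕ→ℚ (a (suc m)) +ℚ inv t)
  cfWith-suc m t =
    trans (cong (λ cs → cfWith a0 cs t) (coeffs-suc m)) (cfWith-∷ʳ a0 (coeffs a m) (a (suc m)) t)

  -- Numerators, shifted like den: num (suc n) = p_n and num 0 = p_{−1} = 1.
  num : ℕ → ℤ
  num zero          = ℤ.+ 1
  num (suc zero)    = a0
  num (suc (suc n)) = ℤ.+ a (suc n) ℤ.* num (suc n) ℤ.+ num n

  numℚ denℚ : ℕ → ℚ
  numℚ n = ℤ→ℚ (num n)
  denℚ n = ℕ→ℚ (den a n)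

  numℚ-rec : ∀ n → numℚ (suc (suc n)) ≡ ℕ→ℚ (a (suc n)) *ℚ numℚ (suc n) +ℚ numℚ n
  numℚ-rec n = trans (ℤ→ℚ-+ (ℤ.+ a (suc n) ℤ.* num (suc n)) (num n))
                     (cong (_+ℚ numℚ n) (ℤ→ℚ-* (ℤ.+ a (suc n)) (num (suc n))))

  denℚ-rec : ∀ n → denℚ (suc (suc n)) ≡ ℕ→ℚ (a (suc n)) *ℚ denℚ (suc n) +ℚ denℚ n
  denℚ-rec n = trans (ℕ→ℚ-+ (a (suc n) * den a (suc n)) (den a n))
                     (cong (_+ℚ denℚ n) (ℕ→ℚ-* (a (suc n)) (den a (suc n))))

  cfWith-möbius : ∀ m {t} → Positive t →
    cfWith a0 (coeffs a m) t *ℚ (denℚ (suc m) *ℚ t +ℚ denℚ m) ≡ numℚ (suc m) *ℚ t +ℚ numℚ m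
  cfWith-möbius zero {t} t>0 = begin
    (A +ℚ inv t) *ℚ (1ℚ *ℚ t +ℚ 0ℚ)
      ≡⟨ cong ((A +ℚ inv t) *ℚ_) (trans (ℚP.+-identityʳ _) (ℚP.*-identityˡ t)) ⟩
    (A +ℚ inv t) *ℚ t              ≡⟨ ℚP.*-distribʳ-+ t A (inv t) ⟩
    A *ℚ t +ℚ inv t *ℚ t           ≡⟨ cong (A *ℚ t +ℚ_) (inv-inverseˡ (pos⇒≢0 t t>0)) ⟩
    A *ℚ t +ℚ 1ℚ                   ∎
    where
    open ≡-Reasoning
    A = ℤ→ℚ a0
  cfWith-möbius (suc m) {t} t>0 = begin
    cfWith a0 (coeffs a (suc m)) t *ℚ (denℚ (suc (suc m)) *ℚ t +ℚ Q₁)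
      ≡⟨ cong₂ (λ h q → h *ℚ (q *ℚ t +ℚ Q₁)) (cfWith-suc m t) (denℚ-rec m) ⟩
    h *ℚ ((c *ℚ Q₁ +ℚ Q₀) *ℚ t +ℚ Q₁)   ≡⟨ cong (h *ℚ_) (sym (absorb-inverse it≡1 c Q₁ Q₀)) ⟩
    h *ℚ ((Q₁ *ℚ s +ℚ Q₀) *ℚ t)         ≡⟨ sym (ℚP.*-assoc h _ t) ⟩
    h *ℚ (Q₁ *ℚ s +ℚ Q₀) *ℚ t           ≡⟨ cong (_*ℚ t) (cfWith-möbius m s>0) ⟩
    (P₁ *ℚ s +ℚ P₀) *ℚ t                ≡⟨ absorb-inverse it≡1 c P₁ P₀ ⟩
    (c *ℚ P₁ +ℚ P₀) *ℚ t +ℚ P₁          ≡⟨ cong (λ p → p *ℚ t +ℚ P₁) (sym (numℚ-rec m)) ⟩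
    numℚ (suc (suc m)) *ℚ t +ℚ P₁       ∎
    where
    open ≡-Reasoning
    c = ℕ→ℚ (a (suc m))
    s = c +ℚ inv t
    h = cfWith a0 (coeffs a m) s
    Q₁ = denℚ (suc m)
    Q₀ = denℚ m
    P₁ = numℚ (suc m)
    P₀ = numℚ m
    it≡1 : inv t *ℚ t ≡ 1ℚ
    it≡1 = inv-inverseˡ (pos⇒≢0 t t>0)
    s>0 : Positive s
    s>0 = ℚP.nonNeg+pos⇒pos c {{ℕ→ℚ-nonNeg (a (suc m))}} (inv t) {{inv-pos t t>0}}

  convergent-mul-den : ∀ m → (1 ≤ m → a m ≢ 0) → convergent m *ℚ denℚ (suc m) ≡ numℚ (suc m)
  convergent-mul-den zero    _     = ℚP.*-identityʳ (ℤ→ℚ a0)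
  convergent-mul-den (suc m) aₘ≢0 = begin
    convergent (suc m) *ℚ denℚ (suc (suc m))
      ≡⟨ cong₂ _*ℚ_ (convergent-suc m) (denℚ-rec m) ⟩
    h *ℚ (c *ℚ Q₁ +ℚ Q₀)                        ≡⟨ cong (λ q → h *ℚ (q +ℚ Q₀)) (ℚP.*-comm c Q₁) ⟩
    h *ℚ (Q₁ *ℚ c +ℚ Q₀)                        ≡⟨ cfWith-möbius m (ℕ→ℚ-pos (aₘ≢0 (s≤s z≤n))) ⟩
    numℚ (suc m) *ℚ c +ℚ numℚ m                 ≡⟨ cong (_+ℚ numℚ m) (ℚP.*-comm (numℚ (suc m)) c) ⟩
    c *ℚ numℚ (suc m) +ℚ numℚ m                 ≡⟨ sym (numℚ-rec m) ⟩
    numℚ (suc (suc m))                          ∎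
    where
    open ≡-Reasoning
    c = ℕ→ℚ (a (suc m))
    h = cfWith a0 (coeffs a m) c
    Q₁ = denℚ (suc m)
    Q₀ = denℚ m

  denℤ : ℕ → ℤ
  denℤ n = ℤ.+ den a n

  denℤ-rec : ∀ n → denℤ (suc (suc n)) ≡ ℤ.+ a (suc n) ℤ.* denℤ (suc n) ℤ.+ denℤ n
  denℤ-rec n = trans (ℤP.pos-+ (a (suc n) * den a (suc n)) (den a n))
                     (cong (ℤ._+ denℤ n) (ℤP.pos-* (a (suc n)) (den a (suc n))))

  det : ℕ → ℤ
  det n = num (suc n) ℤ.* denℤ n ℤ.- num n ℤ.* denℤ (suc n)

  det-zero : det 0 ≡ ℤ.- ℤ.+ 1
  det-zero = cong (ℤ._- ℤ.+ 1) (ℤP.*-zeroʳ a0)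

  det-suc : ∀ n → det (suc n) ≡ ℤ.- det n
  det-suc n = begin
    num (suc (suc n)) ℤ.* D₁ ℤ.- N₁ ℤ.* denℤ (suc (suc n))
      ≡⟨ cong (λ d → num (suc (suc n)) ℤ.* D₁ ℤ.- N₁ ℤ.* d) (denℤ-rec n) ⟩
    (A ℤ.* N₁ ℤ.+ N₀) ℤ.* D₁ ℤ.- N₁ ℤ.* (A ℤ.* D₁ ℤ.+ D₀)
      ≡⟨ expand A N₁ N₀ D₁ D₀ ⟩
    ℤ.- (N₁ ℤ.* D₀ ℤ.- N₀ ℤ.* D₁) ∎
    where
    open ≡-Reasoning
    A = ℤ.+ a (suc n)
    N₁ = num (suc n)
    N₀ = num n
    D₁ = denℤ (suc n)
    D₀ = denℤ n
    expand : ∀ A N₁ N₀ D₁ D₀ →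
      (A ℤ.* N₁ ℤ.+ N₀) ℤ.* D₁ ℤ.- N₁ ℤ.* (A ℤ.* D₁ ℤ.+ D₀) ≡ ℤ.- (N₁ ℤ.* D₀ ℤ.- N₀ ℤ.* D₁)
    expand A N₁ N₀ D₁ D₀ = solveℤ (A ∷ N₁ ∷ N₀ ∷ D₁ ∷ D₀ ∷ [])

  ∣det∣≡1 : ∀ n → ℤ.∣ det n ∣ ≡ 1
  ∣det∣≡1 zero    = cong ℤ.∣_∣ det-zero
  ∣det∣≡1 (suc n) = trans (cong ℤ.∣_∣ (det-suc n)) (trans (ℤP.∣-i∣≡∣i∣ (det n)) (∣det∣≡1 n))

  det-odd : ∀ t → det (suc (2 * t)) ≡ ℤ.+ 1
  det-odd zero    = trans (det-suc 0) (cong ℤ.-_ det-zero)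
  det-odd (suc t) = begin
    det (suc (2 * suc t))          ≡⟨ cong (det ∘ suc) (ℕP.*-suc 2 t) ⟩
    det (suc (suc (suc (2 * t))))  ≡⟨ det-suc _ ⟩
    ℤ.- det (suc (suc (2 * t)))    ≡⟨ cong ℤ.-_ (det-suc _) ⟩
    ℤ.- ℤ.- det (suc (2 * t))      ≡⟨ ℤP.neg-involutive _ ⟩
    det (suc (2 * t))              ≡⟨ det-odd t ⟩
    ℤ.+ 1                          ∎
    where open ≡-Reasoning

  convergent-coprime : ∀ n → Coprime (den a (suc n)) ℤ.∣ num (suc n) ∣
  convergent-coprime n {d} (d∣q , d∣p) =
    ℕD.∣1⇒≡1 (subst (d ℕD.∣_) (∣det∣≡1 (suc n)) (ℤD.∣⇒∣ᵤ d∣det))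
    where
    d∣det : ℤ.+ d ℤD.∣ det (suc n)
    d∣det = ℤD.∣m∣n⇒∣m-n (ℤD.∣n⇒∣m*n (num (suc (suc n))) (ℤD.∣ᵤ⇒∣ {ℤ.+ d} {denℤ (suc n)} d∣q))
                         (ℤD.∣m⇒∣m*n (denℤ (suc (suc n))) (ℤD.∣ᵤ⇒∣ {ℤ.+ d} {num (suc n)} d∣p))

  num-cross : ∀ n → num (suc (suc (suc n))) ℤ.* denℤ (suc n)
                  ≡ num (suc n) ℤ.* denℤ (suc (suc (suc n))) ℤ.+ ℤ.+ a (suc (suc n)) ℤ.* det (suc n)
  num-cross n = begin
    (A ℤ.* N₂ ℤ.+ N₁) ℤ.* D₁
      ≡⟨ expand A N₂ N₁ D₂ D₁ ⟩
    N₁ ℤ.* (A ℤ.* D₂ ℤ.+ D₁) ℤ.+ A ℤ.* (N₂ ℤ.* D₁ ℤ.- N₁ ℤ.* D₂)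
      ≡⟨ cong (λ d → N₁ ℤ.* d ℤ.+ A ℤ.* det (suc n)) (sym (denℤ-rec (suc n))) ⟩
    N₁ ℤ.* denℤ (suc (suc (suc n))) ℤ.+ A ℤ.* det (suc n) ∎
    where
    open ≡-Reasoning
    A = ℤ.+ a (suc (suc n))
    N₂ = num (suc (suc n))
    N₁ = num (suc n)
    D₂ = denℤ (suc (suc n))
    D₁ = denℤ (suc n)
    expand : ∀ A N₂ N₁ D₂ D₁ →
      (A ℤ.* N₂ ℤ.+ N₁) ℤ.* D₁ ≡ N₁ ℤ.* (A ℤ.* D₂ ℤ.+ D₁) ℤ.+ A ℤ.* (N₂ ℤ.* D₁ ℤ.- N₁ ℤ.* D₂)
    expand A N₂ N₁ D₂ D₁ = solveℤ (A ∷ N₂ ∷ N₁ ∷ D₂ ∷ D₁ ∷ [])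

  num-cross-even : ∀ t → let m = 2 * t in
    num (suc (suc (suc m))) ℤ.* denℤ (suc m)
      ≡ num (suc m) ℤ.* denℤ (suc (suc (suc m))) ℤ.+ ℤ.+ a (suc (suc m))
  num-cross-even t = begin
    num (suc (suc (suc m))) ℤ.* denℤ (suc m)         ≡⟨ num-cross m ⟩
    N₁D₃ ℤ.+ A ℤ.* det (suc m)                       ≡⟨ cong (λ e → N₁D₃ ℤ.+ A ℤ.* e) (det-odd t) ⟩
    N₁D₃ ℤ.+ A ℤ.* ℤ.+ 1                             ≡⟨ cong (λ e → N₁D₃ ℤ.+ e) (ℤP.*-identityʳ A) ⟩
    N₁D₃ ℤ.+ A                                       ∎
    where
    open ≡-Reasoning
    m = 2 * t
    A = ℤ.+ a (suc (suc m))
    N₁D₃ = num (suc m) ℤ.* denℤ (suc (suc (suc m)))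

  convergent-add-reciprocal : ∀ t → let m = 2 * t in
    a (suc (suc m)) ≡ den a (suc m) → den a (suc m) ≢ 0 →
    convergent m *ℚ denℚ (suc m) ≡ numℚ (suc m) →
    convergent (suc (suc m)) ≡ convergent m +ℚ inv (denℚ (suc (suc (suc m))))
  convergent-add-reciprocal t aₘ₊₂≡qₘ qₘ≢0 Vq≡p =
    add-inverse-by-cross-multiplication
      {i = inv (denℚ (suc (suc (suc m))))} {j = inv (denℚ (suc m))}
      {A = convergent m} {B = convergent (suc (suc m))}
      (inv-inverseˡ (pos⇒≢0 (denℚ (suc (suc (suc m)))) (ℕ→ℚ-pos q′≢0)))
      (inv-inverseˡ (pos⇒≢0 (denℚ (suc m)) (ℕ→ℚ-pos qₘ≢0)))
      Vq≡p (convergent-mul-den (suc (suc m)) (λ _ → qₘ≢0 ∘ trans (sym aₘ₊₂≡qₘ))) cross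
    where
    m = 2 * t
    q′≢0 : den a (suc (suc (suc m))) ≢ 0
    q′≢0 = qₘ≢0 ∘ ℕP.m+n≡0⇒n≡0 (a (suc (suc m)) * den a (suc (suc m)))
    N₁ = num (suc m)
    N₃ = num (suc (suc (suc m)))
    D₁ = denℤ (suc m)
    D₃ = denℤ (suc (suc (suc m)))
    crossℤ : N₃ ℤ.* D₁ ≡ N₁ ℤ.* D₃ ℤ.+ D₁
    crossℤ = trans (num-cross-even t) (cong (λ q → N₁ ℤ.* D₃ ℤ.+ ℤ.+ q) aₘ₊₂≡qₘ)
    cross : numℚ (suc (suc (suc m))) *ℚ denℚ (suc m)
          ≡ numℚ (suc m) *ℚ denℚ (suc (suc (suc m))) +ℚ denℚ (suc m)
    cross = begin
      ℤ→ℚ N₃ *ℚ ℤ→ℚ D₁             ≡⟨ sym (ℤ→ℚ-* N₃ D₁) ⟩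
      ℤ→ℚ (N₃ ℤ.* D₁)              ≡⟨ cong ℤ→ℚ crossℤ ⟩
      ℤ→ℚ (N₁ ℤ.* D₃ ℤ.+ D₁)       ≡⟨ ℤ→ℚ-+ (N₁ ℤ.* D₃) D₁ ⟩
      ℤ→ℚ (N₁ ℤ.* D₃) +ℚ ℤ→ℚ D₁    ≡⟨ cong (_+ℚ ℤ→ℚ D₁) (ℤ→ℚ-* N₁ D₃) ⟩
      ℤ→ℚ N₁ *ℚ ℤ→ℚ D₃ +ℚ ℤ→ℚ D₁   ∎
      where open ≡-Reasoning

module Expansion (r : ℚ) (k : ℕ) (a0 : ℤ) (a : ℕ → ℕ) (z x y : ℕ → ℕ)
  (a-pos : ∀ i → 1 ≤ i → i ≤ 2 * k → 0 < a i)
  (r≡cf : r ≡ cf a0 (coeffs a (2 * k)))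
  (x₁≡↧r : x 1 ≡ ↧ₙ r)
  (y₀≡q+1 : y 0 ≡ den a (2 * k) + 1)
  (x-rec : ∀ n → 1 ≤ n → x (suc n) ≡ x n * y (n ∸ 1) * (x n * z n + 1))
  (x≡xy : ∀ n → 1 ≤ n → x (suc n) ≡ x n * y n)
  (a-odd : ∀ j → 1 ≤ j → a (2 * k + 2 * j ∸ 1) ≡ y (j ∸ 1) * z j)
  (a-even : ∀ j → 1 ≤ j → a (2 * k + 2 * j) ≡ x j) where

  open Convergents a0 a

  order-suc : ∀ n → 2 * (k + suc n) ≡ suc (suc (2 * (k + n)))
  order-suc n = trans (cong (2 *_) (ℕP.+-suc k n)) (ℕP.*-suc 2 (k + n))

  even-index : ∀ n → 2 * k + 2 * suc n ≡ suc (suc (2 * (k + n)))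
  even-index n = trans (sym (ℕP.*-distribˡ-+ 2 k (suc n))) (order-suc n)

  a-odd′ : ∀ n → a (suc (2 * (k + n))) ≡ y n * z (suc n)
  a-odd′ n = trans (cong (λ i → a (i ∸ 1)) (sym (even-index n))) (a-odd (suc n) (s≤s z≤n))

  a-even′ : ∀ n → a (suc (suc (2 * (k + n)))) ≡ x (suc n)
  a-even′ n = trans (cong a (sym (even-index n))) (a-even (suc n) (s≤s z≤n))

  record Stage (n m : ℕ) : Set where
    field
      partial-sum    : S r x (suc n) ≡ convergent m
      convergent-num : convergent m *ℚ denℚ (suc m) ≡ numℚ (suc m)
      x≡den          : x (suc n) ≡ den a (suc m)
      y≡den+1        : y n ≡ den a m + 1
      x≢0            : x (suc n) ≢ 0

  first-stage : Stage 0 (2 * k)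
  first-stage = record
    { partial-sum    = r≡cf
    ; convergent-num = Vq≡p
    ; x≡den          = trans x₁≡↧r (trans (cong ↧ₙ_ r≡cf)
                                          (↧ₙ-unique V p _ Vq≡p (convergent-coprime (2 * k))))
    ; y≡den+1        = y₀≡q+1
    ; x≢0            = ℕP.1+n≢0 ∘ trans (sym x₁≡↧r)
    }
    where
    V = convergent (2 * k)
    p = num (suc (2 * k))
    Vq≡p : V *ℚ denℚ (suc (2 * k)) ≡ ℤ→ℚ p
    Vq≡p = convergent-mul-den (2 * k) (λ 1≤2k → ℕP.n>0⇒n≢0 (a-pos (2 * k) 1≤2k ℕP.≤-refl))

  module Step (n : ℕ) (st : Stage n (2 * (k + n))) where
    open Stage st
    open ≡-Reasoning

    m = 2 * (k + n)
    δ = den a m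
    x′ = x (suc n)
    z′ = z (suc n)

    factor : ∀ X d Z → X * ((d + 1) * Z * X + d) + X ≡ X * (d + 1) * (X * Z + 1)
    factor X d Z = solveℕ (X ∷ d ∷ Z ∷ [])

    den-next : den a (suc (suc (suc m))) ≡ x (suc (suc n))
    den-next = begin
      a (suc (suc m)) * (a (suc m) * den a (suc m) + δ) + den a (suc m)
        ≡⟨ cong₂ (λ u v → u * (v * den a (suc m) + δ) + den a (suc m)) (a-even′ n) (a-odd′ n) ⟩
      x′ * (y n * z′ * den a (suc m) + δ) + den a (suc m)
        ≡⟨ cong (λ q → x′ * (y n * z′ * q + δ) + q) (sym x≡den) ⟩
      x′ * (y n * z′ * x′ + δ) + x′
        ≡⟨ cong (λ w → x′ * (w * z′ * x′ + δ) + x′) y≡den+1 ⟩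
      x′ * ((δ + 1) * z′ * x′ + δ) + x′
        ≡⟨ factor x′ δ z′ ⟩
      x′ * (δ + 1) * (x′ * z′ + 1)
        ≡⟨ cong (λ w → x′ * w * (x′ * z′ + 1)) (sym y≡den+1) ⟩
      x′ * y n * (x′ * z′ + 1)
        ≡⟨ sym (x-rec (suc n) (s≤s z≤n)) ⟩
      x (suc (suc n)) ∎

    y-next : y (suc n) ≡ den a (suc (suc m)) + 1
    y-next = ℕP.*-cancelˡ-≡ _ _ x′ {{ℕ.≢-nonZero x≢0}} (begin
      x′ * y (suc n)                                         ≡⟨ sym (x≡xy (suc n) (s≤s z≤n)) ⟩
      x (suc (suc n))                                        ≡⟨ sym den-next ⟩
      a (suc (suc m)) * den a (suc (suc m)) + den a (suc m)
        ≡⟨ cong₂ (λ u v → u * den a (suc (suc m)) + v) (a-even′ n) (sym x≡den) ⟩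
      x′ * den a (suc (suc m)) + x′
        ≡⟨ cong (x′ * den a (suc (suc m)) +_) (sym (ℕP.*-identityʳ x′)) ⟩
      x′ * den a (suc (suc m)) + x′ * 1                     ≡⟨ sym (ℕP.*-distribˡ-+ x′ _ 1) ⟩
      x′ * (den a (suc (suc m)) + 1)                         ∎)

    x-next≢0 : x (suc (suc n)) ≢ 0
    x-next≢0 x″≡0 with ℕP.m*n≡0⇒m≡0∨n≡0 x′ (trans (sym (x≡xy (suc n) (s≤s z≤n))) x″≡0)
    ... | inj₁ x′≡0 = x≢0 x′≡0
    ... | inj₂ y′≡0 = ℕP.1+n≢0 (ℕP.m+n≡0⇒n≡0 (den a (suc (suc m))) (trans (sym y-next) y′≡0))

    sum-next : S r x (suc (suc n)) ≡ convergent (suc (suc m))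
    sum-next = begin
      S r x (suc n) +ℚ inv (ℕ→ℚ (x (suc (suc n))))
        ≡⟨ cong₂ (λ s q → s +ℚ inv (ℕ→ℚ q)) partial-sum (sym den-next) ⟩
      convergent m +ℚ inv (denℚ (suc (suc (suc m))))
        ≡⟨ sym (convergent-add-reciprocal (k + n) (trans (a-even′ n) x≡den) (x≢0 ∘ trans x≡den)
                                          convergent-num) ⟩
      convergent (suc (suc m)) ∎

    next-stage : Stage (suc n) (suc (suc m))
    next-stage = record
      { partial-sum    = sum-next
      ; convergent-num = convergent-mul-den (suc (suc m)) (λ _ → x≢0 ∘ trans (sym (a-even′ n)))
      ; x≡den          = sym den-next
      ; y≡den+1        = y-next
      ; x≢0            = x-next≢0
      }

  stage : ∀ n → Stage n (2 * (k + n))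
  stage zero    = subst (Stage 0) (cong (2 *_) (sym (ℕP.+-identityʳ k))) first-stage
  stage (suc n) = subst (Stage (suc n)) (sym (order-suc n)) (Step.next-stage n (stage n))

theorem1 : (r : ℚ) (k : ℕ) (a0 : ℤ) (a : ℕ → ℕ) (z x y : ℕ → ℕ) →
    (∀ i → 1 ≤ i → i ≤ 2 * k → 0 < a i) →
    r ≡ cf a0 (coeffs a (2 * k)) →
    (∀ n → 1 ≤ n → 0 < z n) →
    x 1 ≡ ↧ₙ r →
    y 0 ≡ den a (2 * k) + 1 →
    (∀ n → 1 ≤ n → x (suc n) ≡ x n * y (n ∸ 1) * (x n * z n + 1)) →
    (∀ n → 1 ≤ n → x (suc n) ≡ x n * y n) →
    (∀ j → 1 ≤ j → a (2 * k + 2 * j ∸ 1) ≡ y (j ∸ 1) * z j) →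
    (∀ j → 1 ≤ j → a (2 * k + 2 * j) ≡ x j) →
    ∀ n → 1 ≤ n → S r x n ≡ cf a0 (coeffs a (2 * (k + n ∸ 1)))
theorem1 r k a0 a z x y a-pos r≡cf _ x₁≡↧r y₀≡q+1 x-rec x≡xy a-odd a-even (suc n) _ =
  trans (Stage.partial-sum (stage n))
        (cong (λ i → cf a0 (coeffs a (2 * (i ∸ 1)))) (sym (ℕP.+-suc k n)))
  where open Expansion r k a0 a z x y a-pos r≡cf x₁≡↧r y₀≡q+1 x-rec x≡xy a-odd a-even
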